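{- Let $V$ be a finite set, let $d_1,d_2$ be metrics on $V$, let $q\in\mathbb{N}$, and let $(T_1,T_2)$ be an optimal solution of the Recoverable Spanning Tree instance $(V,d_1,d_2,q)$. Let $K_1,\dots,K_r$ be the connected components of the graph formed by the edge set $T_1\cap T_2$. For each $j=1,\dots,r$, let $P_j$ be a Hamiltonian path on the vertex set of $K_j$ computed by the double-tree heuristic applied to the TSP on the vertex set of $K_j$ with distance function $d_1+d_2$. For $i=1,2$ let $T_i'$ be obtained from $T_i$ by replacing, for each $j$, the edges of $K_j$ by the edges of $P_j$. Then $d_1(T_1')+d_2(T_2')\le 2\,(d_1(T_1)+d_2(T_2))$.
   Context: For an edge set $F$ and $d:\binom{V}{2}\to\mathbb{R}_{\ge0}$ write $d(F)=\sum_{e\in F}d(e)$. The Recoverable Spanning Tree problem on instance $(V,d_1,d_2,q)$ asks for two spanning trees $T_1,T_2$ of the complete graph on $V$ (viewed as edge sets) with $|T_1\cap T_2|\ge q$ minimizing $d_1(T_1)+d_2(T_2)$. The double-tree heuristic for the TSP on a vertex set $U$ with metric $d$ computes a minimum spanning tree of $U$ with respect to $d$, doubles each of its edges, takes an Eulerian circuit of the resulting multigraph and shortcuts repeated vertices to obtain a tour on $U$; a Hamiltonian path on $U$ is obtained from this tour by deleting one of its edges. -}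

module Defs where

open import Level using (Level; suc; _⊔_; 0ℓ)
open import Data.Bool using (Bool; true; false; _∧_; _∨_; not; if_then_else_)
open import Data.Nat as ℕ using (ℕ; zero; _<ᵇ_)
open import Data.Fin using (Fin; toℕ; _≟_)
open import Data.List using (List; []; _∷_; _++_; allFin; deduplicate; length; foldr; map; cartesianProduct)
open import Data.List.Relation.Unary.All using (All)
open import Data.List.Relation.Unary.Unique.Propositional using (Unique)
open import Data.Product using (Σ; _×_; _,_; ∃; proj₁; proj₂)
open import Data.Sum using (_⊎_)
open import Data.Unit using (⊤)
open import Data.Bool.ListAction using (any)
open import Data.Empty using (⊥)
open import Relation.Binary.PropositionalEquality using (_≡_)
open import Relation.Nullary.Decidable using (⌊_⌋)

-- Value domain for distances.  ℝ is not available in agda-stdlib; we work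
-- over an arbitrary totally ordered commutative monoid (ℝ with +, 0, ≤
-- is an instance).  "2 · x" is written x + x.

record OrderedCommMonoid (c ℓ : Level) : Set (suc (c ⊔ ℓ)) where
  infixl 6 _+_
  infix 4 _≤_
  field
    Carrier     : Set c
    0#          : Carrier
    _+_         : Carrier → Carrier → Carrier
    _≤_         : Carrier → Carrier → Set ℓ
    +-assoc     : ∀ x y z → (x + y) + z ≡ x + (y + z)
    +-comm      : ∀ x y → x + y ≡ y + x
    +-identityˡ : ∀ x → 0# + x ≡ x
    ≤-refl      : ∀ {x} → x ≤ x
    ≤-trans     : ∀ {x y z} → x ≤ y → y ≤ z → x ≤ z
    ≤-antisym   : ∀ {x y} → x ≤ y → y ≤ x → x ≡ y
    ≤-total     : ∀ x y → (x ≤ y) ⊎ (y ≤ x)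
    +-monoˡ-≤   : ∀ {x y} z → x ≤ y → x + z ≤ y + z

  sumL : List Carrier → Carrier
  sumL = foldr _+_ 0#

-- An edge set is a Boolean function; the edge {i,j} (i ≠ j) is present
-- iff  E i j ≡ true  where toℕ i < toℕ j  (entries with i ≥ j are ignored).

EdgeSet : ℕ → Set
EdgeSet n = Fin n → Fin n → Bool

edge : ∀ {n} → EdgeSet n → Fin n → Fin n → Bool
edge E i j = if toℕ i <ᵇ toℕ j then E i j
             else (if toℕ j <ᵇ toℕ i then E j i else false)

_∩_ : ∀ {n} → EdgeSet n → EdgeSet n → EdgeSet n
(E ∩ F) i j = E i j ∧ F i j

allPairs : ∀ n → List (Fin n × Fin n)
allPairs n = cartesianProduct (allFin n) (allFin n)

size : ∀ {n} → EdgeSet n → ℕ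
size {n} E = foldr ℕ._+_ 0
  (map (λ p → if (toℕ (proj₁ p) <ᵇ toℕ (proj₂ p)) ∧ E (proj₁ p) (proj₂ p) then 1 else 0)
       (allPairs n))

data Walk {n} (E : EdgeSet n) : Fin n → Fin n → Set where
  here  : ∀ {i} → Walk E i i
  step  : ∀ {i j k} → edge E i j ≡ true → Walk E j k → Walk E i k

Steps : ∀ {n} → EdgeSet n → List (Fin n) → Set
Steps E []           = ⊤
Steps E (x ∷ [])     = ⊤
Steps E (x ∷ y ∷ l)  = (edge E x y ≡ true) × Steps E (y ∷ l)

HasCycle : ∀ {n} → EdgeSet n → Set
HasCycle {n} E = Σ (Fin n) λ x → Σ (List (Fin n)) λ l →
  (2 ℕ.≤ length l) × Unique (x ∷ l) × Steps E (x ∷ (l ++ x ∷ []))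

SpanningTreeOn : ∀ {n} → (Fin n → Set) → EdgeSet n → Set
SpanningTreeOn {n} U E =
  (∀ i j → edge E i j ≡ true → U i × U j) ×
  (∀ i j → U i → U j → Walk E i j) ×
  (HasCycle E → ⊥)

SpanningTree : ∀ {n} → EdgeSet n → Set
SpanningTree = SpanningTreeOn (λ _ → ⊤)

pathEdges : ∀ {n} → List (Fin n) → EdgeSet n
pathEdges []          i j = false
pathEdges (x ∷ [])    i j = false
pathEdges (x ∷ y ∷ l) i j =
  (⌊ x ≟ i ⌋ ∧ ⌊ y ≟ j ⌋) ∨ (⌊ x ≟ j ⌋ ∧ ⌊ y ≟ i ⌋) ∨ pathEdges (y ∷ l) i j

traversals : ∀ {n} → List (Fin n) → Fin n → Fin n → ℕ
traversals []          i j = 0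
traversals (x ∷ [])    i j = 0
traversals (x ∷ y ∷ l) i j =
  (if (⌊ x ≟ i ⌋ ∧ ⌊ y ≟ j ⌋) ∨ (⌊ x ≟ j ⌋ ∧ ⌊ y ≟ i ⌋) then 1 else 0)
  ℕ.+ traversals (y ∷ l) i j

module _ {c ℓ} (A : OrderedCommMonoid c ℓ) where
  open OrderedCommMonoid A

  Dist : ℕ → Set c
  Dist n = Fin n → Fin n → Carrier

  record Metric {n} (d : Dist n) : Set (c ⊔ ℓ) where
    field
      self    : ∀ i → d i i ≡ 0#
      sep     : ∀ i j → d i j ≡ 0# → i ≡ j
      nonneg  : ∀ i j → 0# ≤ d i j
      sym     : ∀ i j → d i j ≡ d j i
      triangle : ∀ i j k → d i k ≤ d i j + d j k

  _⊕_ : ∀ {n} → Dist n → Dist n → Dist n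
  (d ⊕ d') i j = d i j + d' i j

  weight : ∀ {n} → Dist n → EdgeSet n → Carrier
  weight {n} d E = sumL
    (map (λ p → if (toℕ (proj₁ p) <ᵇ toℕ (proj₂ p)) ∧ E (proj₁ p) (proj₂ p)
                then d (proj₁ p) (proj₂ p) else 0#)
         (allPairs n))

  MST : ∀ {n} → Dist n → (Fin n → Set) → EdgeSet n → Set ℓ
  MST {n} d U M = SpanningTreeOn U M ×
    (∀ (M' : EdgeSet n) → SpanningTreeOn U M' → weight d M ≤ weight d M')

  -- P is (the edge set of) a Hamiltonian path on U produced by the
  -- double-tree heuristic for the TSP on U with metric d:
  --  * M is a minimum spanning tree of U w.r.t. d;
  --  * x ∷ r is an Eulerian circuit of the multigraph obtained by doubling
  --    every edge of M (a closed walk in U traversing each edge of M exactly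
  --    twice and no other edge);
  --  * the tour is obtained by shortcutting (keeping first occurrences);
  --  * the path deletes one edge of the tour: writing tour = a ++ b, the
  --    deleted edge is the one from the last vertex of a to the first of b,
  --    leaving the path b ++ a.
  DoubleTreePath : ∀ {n} → Dist n → (Fin n → Set) → EdgeSet n → Set ℓ
  DoubleTreePath {n} d U P =
    Σ (EdgeSet n) λ M → MST d U M ×
    Σ (Fin n) λ x → Σ (List (Fin n)) λ r →
      ((r ≡ []) ⊎ (Σ (List (Fin n)) λ r' → r ≡ r' ++ x ∷ [])) ×
      All U (x ∷ r) ×
      Steps M (x ∷ r) ×
      (∀ i j → toℕ i ℕ.< toℕ j → traversals (x ∷ r) i j ≡ (if M i j then 2 else 0)) ×
      Σ (List (Fin n)) λ a → Σ (List (Fin n)) λ b →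
        (deduplicate _≟_ (x ∷ r) ≡ a ++ b) ×
        (∀ i j → edge P i j ≡ edge (pathEdges (b ++ a)) i j)

  RSTFeasible : ∀ {n} → ℕ → EdgeSet n → EdgeSet n → Set
  RSTFeasible q T₁ T₂ = SpanningTree T₁ × SpanningTree T₂ × (q ℕ.≤ size (T₁ ∩ T₂))

  RSTcost : ∀ {n} → Dist n → Dist n → EdgeSet n → EdgeSet n → Carrier
  RSTcost d₁ d₂ T₁ T₂ = weight d₁ T₁ + weight d₂ T₂

  RSTOptimal : ∀ {n} → Dist n → Dist n → ℕ → EdgeSet n → EdgeSet n → Set ℓ
  RSTOptimal {n} d₁ d₂ q T₁ T₂ = RSTFeasible q T₁ T₂ ×
    (∀ (S₁ S₂ : EdgeSet n) → RSTFeasible q S₁ S₂ → RSTcost d₁ d₂ T₁ T₂ ≤ RSTcost d₁ d₂ S₁ S₂)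

-- With H = T₁ ∩ T₂ and P v the path chosen for the component of v, this is
-- T with the edges of each component K_j replaced by those of P_j.
replaceEdges : ∀ {n} → EdgeSet n → EdgeSet n → (Fin n → EdgeSet n) → EdgeSet n
replaceEdges {n} T H P i j = (T i j ∧ not (H i j)) ∨ any (λ v → P v i j) (allFin n)

-- Write H = T₁ ∩ T₂ and w = d₁ + d₂. Replacing H by the paths P_j costs at most
-- d₁(T₁ ∖ H) + d₂(T₂ ∖ H) + w(⋃ P_j), while the old cost is d₁(T₁ ∖ H) + d₂(T₂ ∖ H) + w(H).
-- Each P_j is obtained from an Eulerian circuit of a doubled minimum spanning tree M_j of K_j
-- by shortcutting and deleting an edge, so by the triangle inequality w(P_j) ≤ 2 w(M_j); and
-- as H ⊆ T₁ is a forest, the edges of H inside K_j span K_j, whence w(M_j) ≤ w(H ∩ K_j).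
-- Summing over the components gives w(⋃ P_j) ≤ 2 w(H). Optimality of (T₁, T₂) enters only
-- through the acyclicity of T₁.

module Submission where

open import Defs
open import Level using (Level)
open import Algebra.Bundles using (CommutativeMonoid)
import Algebra.Properties.CommutativeMonoid.Sum as Sum
open import Data.Bool using (Bool; true; false; _∧_; _∨_; not; if_then_else_; T)
open import Data.Bool.ListAction using (any)
open import Data.Bool.Properties using (T-≡; ∨-assoc; ∨-comm; ∧-comm; ∧-zeroʳ)
open import Data.Empty using (⊥; ⊥-elim)
open import Data.Fin using (Fin; zero; suc; toℕ; _≟_)
open import Data.Fin.Properties using (toℕ-injective)
open import Data.List using (List; []; _∷_; _++_; allFin; map; tabulate; cartesianProduct; deduplicate; filter) renaming (_∷ʳ_ to _∷ᴸ_)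
open import Data.List.Properties using (map-++; map-∘; map-tabulate; ++-assoc; ++-identityʳ)
open import Data.List.Membership.Propositional using (_∈_)
open import Data.List.Membership.Propositional.Properties using (∈-allFin; ∈-++⁻; ∈-++⁺ˡ; ∈-++⁺ʳ; ∈-deduplicate⁻)
open import Data.List.Membership.DecPropositional using (_∈?_)
open import Data.List.Relation.Binary.Sublist.Propositional using (_⊆_; []; _∷_; _∷ʳ_; ⊆-trans)
open import Data.List.Relation.Binary.Sublist.Propositional.Properties using (filter-⊆)
open import Data.List.Relation.Unary.All using (All; []; _∷_)
import Data.List.Relation.Unary.All as All
open import Data.List.Relation.Unary.All.Properties using (all-filter)
open import Data.List.Relation.Unary.Any using (here; there; satisfied)
open import Data.List.Relation.Unary.Any.Properties using (any⁻)
open import Data.Nat using (ℕ; zero; suc; _<_; _<ᵇ_)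
open import Data.Nat.Properties using (<ᵇ⇒<; <⇒<ᵇ; <-asym; <-irrefl; <-cmp)
open import Data.Product using (Σ; ∃; _×_; _,_; proj₁; proj₂)
import Data.Product as Product
open import Data.Sum using (_⊎_; inj₁; inj₂; [_,_]′)
open import Data.Unit using (tt)
open import Function using (_∘_; id)
open import Function.Bundles using (Equivalence)
open import Relation.Binary.Bundles using (Poset)
open import Relation.Binary.Core using (Rel)
open import Relation.Binary.Definitions using (Decidable; DecidableEquality; tri<; tri≈; tri>)
open import Relation.Binary.PropositionalEquality using (_≡_; refl; sym; trans; cong; cong₂; subst; isEquivalence)
open import Relation.Binary.Structures using (IsEquivalence)
open import Relation.Nullary using (¬_; does; ¬?)
open import Relation.Nullary.Decidable using (Dec; yes; no; ⌊_⌋; map′; toWitness; fromWitness)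

module OrderedCommMonoidProperties {c ℓ} (A : OrderedCommMonoid c ℓ) where
  open OrderedCommMonoid A

  commutativeMonoid : CommutativeMonoid c c
  commutativeMonoid = record
    { Carrier = Carrier ; _≈_ = _≡_ ; _∙_ = _+_ ; ε = 0#
    ; isCommutativeMonoid = record
      { isMonoid = record
        { isSemigroup = record
          { isMagma = record { isEquivalence = isEquivalence ; ∙-cong = cong₂ _+_ }
          ; assoc = +-assoc }
        ; identity = +-identityˡ , λ x → trans (+-comm x 0#) (+-identityˡ x) }
      ; comm = +-comm } }

  poset : Poset c c ℓ
  poset = record
    { Carrier = Carrier ; _≈_ = _≡_ ; _≤_ = _≤_
    ; isPartialOrder = record
      { isPreorder = record
        { isEquivalence = isEquivalence
        ; reflexive = λ { refl → ≤-refl }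
        ; trans = ≤-trans }
      ; antisym = ≤-antisym } }

  open CommutativeMonoid commutativeMonoid public using () renaming (identityʳ to +-identityʳ)
  open Poset poset public using () renaming (reflexive to ≤-reflexive)
  open import Algebra.Properties.CommutativeSemigroup (CommutativeMonoid.commutativeSemigroup commutativeMonoid)
    public using (interchange)
  open import Algebra.Definitions.RawMonoid (CommutativeMonoid.rawMonoid commutativeMonoid) public
    using () renaming (_×_ to _·_)
  open Sum commutativeMonoid public using (sum; ∑-distrib-+; ∑-comm; sum-cong-≗; sum-replicate-zero)
  open import Relation.Binary.Reasoning.PartialOrder poset public

  +-monoʳ-≤ : ∀ {x y} z → x ≤ y → z + x ≤ z + y
  +-monoʳ-≤ {x} {y} z x≤y = begin
    z + x ≡⟨ +-comm z x ⟩
    x + z ≤⟨ +-monoˡ-≤ z x≤y ⟩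
    y + z ≡⟨ +-comm y z ⟩
    z + y ∎

  +-mono-≤ : ∀ {x x′ y y′} → x ≤ x′ → y ≤ y′ → x + y ≤ x′ + y′
  +-mono-≤ {x′ = x′} {y} x≤x′ y≤y′ = ≤-trans (+-monoˡ-≤ y x≤x′) (+-monoʳ-≤ x′ y≤y′)

  x≤y+x : ∀ {x y} → 0# ≤ y → x ≤ y + x
  x≤y+x {x} {y} 0≤y = begin
    x      ≡⟨ +-identityˡ x ⟨
    0# + x ≤⟨ +-monoˡ-≤ x 0≤y ⟩
    y + x  ∎

  x≤x+y : ∀ {x y} → 0# ≤ y → x ≤ x + y
  x≤x+y {x} {y} 0≤y = ≤-trans (x≤y+x 0≤y) (≤-reflexive (+-comm y x))

  x+[y+y]≤[x+y]+[x+y] : ∀ {x} y → 0# ≤ x → x + (y + y) ≤ (x + y) + (x + y)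
  x+[y+y]≤[x+y]+[x+y] {x} y 0≤x = begin
    x + (y + y)       ≡⟨ +-assoc x y y ⟨
    (x + y) + y       ≤⟨ +-monoʳ-≤ (x + y) (x≤y+x 0≤x) ⟩
    (x + y) + (x + y) ∎

  when : Bool → Carrier → Carrier
  when b x = if b then x else 0#

  when-nonneg : ∀ b {x} → 0# ≤ x → 0# ≤ when b x
  when-nonneg true  0≤x = 0≤x
  when-nonneg false _   = ≤-refl

  when-∧ : ∀ a b x → when (a ∧ b) x ≡ when a (when b x)
  when-∧ true  b x = refl
  when-∧ false b x = refl

  when-comm : ∀ a b x → when a (when b x) ≡ when b (when a x)
  when-comm true  b     x = refl
  when-comm false true  x = refl
  when-comm false false x = refl

  when-0# : ∀ b → when b 0# ≡ 0#
  when-0# true  = refl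
  when-0# false = refl

  when-+ : ∀ b x y → when b (x + y) ≡ when b x + when b y
  when-+ true  x y = refl
  when-+ false x y = sym (+-identityˡ 0#)

  ∑-mono-≤ : ∀ {n} {f g : Fin n → Carrier} → (∀ i → f i ≤ g i) → sum f ≤ sum g
  ∑-mono-≤ {zero}  f≤g = ≤-refl
  ∑-mono-≤ {suc n} f≤g = +-mono-≤ (f≤g zero) (∑-mono-≤ (f≤g ∘ suc))

  ∑-nonneg : ∀ {n} {f : Fin n → Carrier} → (∀ i → 0# ≤ f i) → 0# ≤ sum f
  ∑-nonneg {n} 0≤f = ≤-trans (≤-reflexive (sym (sum-replicate-zero n))) (∑-mono-≤ 0≤f)

  ∑-δ : ∀ {n} (x : Fin n) v → sum (λ u → when ⌊ x ≟ u ⌋ v) ≡ v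
  ∑-δ {suc n} zero v = begin-equality
    v + sum {n} (λ _ → 0#) ≡⟨ cong (v +_) (sum-replicate-zero n) ⟩
    v + 0#                 ≡⟨ +-identityʳ v ⟩
    v                      ∎
  ∑-δ {suc n} (suc x) v = begin-equality
    0# + sum {n} (λ u → when ⌊ suc x ≟ suc u ⌋ v) ≡⟨ +-identityˡ _ ⟩
    sum (λ u → when ⌊ suc x ≟ suc u ⌋ v)          ≡⟨ sum-cong-≗ shift ⟩
    sum (λ u → when ⌊ x ≟ u ⌋ v)                  ≡⟨ ∑-δ x v ⟩
    v                                             ∎
    where
    shift : ∀ u → when ⌊ suc x ≟ suc u ⌋ v ≡ when ⌊ x ≟ u ⌋ v
    shift u with x ≟ u
    ... | yes _ = refl
    ... | no  _ = refl

  sumL-++ : ∀ xs ys → sumL (xs ++ ys) ≡ sumL xs + sumL ys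
  sumL-++ []       ys = sym (+-identityˡ (sumL ys))
  sumL-++ (x ∷ xs) ys = trans (cong (x +_) (sumL-++ xs ys)) (sym (+-assoc x (sumL xs) (sumL ys)))

  sumL-allFin : ∀ {n} (f : Fin n → Carrier) → sumL (map f (allFin n)) ≡ sum f
  sumL-allFin f = trans (cong sumL (map-tabulate id f)) (sumL-tabulate f)
    where
    sumL-tabulate : ∀ {n} (f : Fin n → Carrier) → sumL (tabulate f) ≡ sum f
    sumL-tabulate {zero}  f = refl
    sumL-tabulate {suc n} f = cong (f zero +_) (sumL-tabulate (f ∘ suc))

  sumL-cartesianProduct : ∀ {a b} {X : Set a} {Y : Set b} (f : X × Y → Carrier) xs ys →
    sumL (map f (cartesianProduct xs ys)) ≡ sumL (map (λ x → sumL (map (λ y → f (x , y)) ys)) xs)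
  sumL-cartesianProduct f []       ys = refl
  sumL-cartesianProduct f (x ∷ xs) ys = begin-equality
    sumL (map f (map (x ,_) ys ++ cartesianProduct xs ys))
      ≡⟨ cong sumL (map-++ f (map (x ,_) ys) (cartesianProduct xs ys)) ⟩
    sumL (map f (map (x ,_) ys) ++ map f (cartesianProduct xs ys))
      ≡⟨ sumL-++ (map f (map (x ,_) ys)) (map f (cartesianProduct xs ys)) ⟩
    sumL (map f (map (x ,_) ys)) + sumL (map f (cartesianProduct xs ys))
      ≡⟨ cong₂ _+_ (cong sumL (sym (map-∘ ys))) (sumL-cartesianProduct f xs ys) ⟩
    sumL (map (λ y → f (x , y)) ys) + sumL (map (λ x → sumL (map (λ y → f (x , y)) ys)) xs) ∎

∨-true : ∀ {a b} → a ∨ b ≡ true → a ≡ true ⊎ b ≡ true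
∨-true {true}  _ = inj₁ refl
∨-true {false} e = inj₂ e

∧-true : ∀ {a b} → a ∧ b ≡ true → a ≡ true × b ≡ true
∧-true {true} e = refl , e

module _ {n : ℕ} where

  ordered : Fin n → Fin n → Bool
  ordered i j = toℕ i <ᵇ toℕ j

  ordered⇒< : ∀ {i j} → ordered i j ≡ true → toℕ i < toℕ j
  ordered⇒< {i} {j} e = <ᵇ⇒< (toℕ i) (toℕ j) (Equivalence.from T-≡ e)

  <⇒ordered : ∀ {i j} → toℕ i < toℕ j → ordered i j ≡ true
  <⇒ordered i<j = Equivalence.to T-≡ (<⇒<ᵇ i<j)

  edge-ordered : ∀ (E : EdgeSet n) {i j} → ordered i j ≡ true → edge E i j ≡ E i j
  edge-ordered E e rewrite e = refl

  edge-sym : ∀ (E : EdgeSet n) i j → edge E i j ≡ edge E j i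
  edge-sym E i j with ordered i j in eᵢⱼ | ordered j i in eⱼᵢ
  ... | true  | true  = ⊥-elim (<-asym (ordered⇒< {i} {j} eᵢⱼ) (ordered⇒< {j} {i} eⱼᵢ))
  ... | true  | false = refl
  ... | false | true  = refl
  ... | false | false = refl

  -- Only the entries E i j with toℕ i < toℕ j encode edges.
  _⊆ᴱ_ : EdgeSet n → EdgeSet n → Set
  E ⊆ᴱ F = ∀ {i j} → ordered i j ≡ true → E i j ≡ true → F i j ≡ true

  ⊆ᴱ-edge : ∀ {E F} → E ⊆ᴱ F → ∀ i j → edge E i j ≡ true → edge F i j ≡ true
  ⊆ᴱ-edge {E} {F} E⊆F i j with ordered i j in eᵢⱼ | ordered j i in eⱼᵢ
  ... | true  | _     = E⊆F eᵢⱼ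
  ... | false | true  = E⊆F eⱼᵢ
  ... | false | false = λ ()

  _∪_ _∖_ : EdgeSet n → EdgeSet n → EdgeSet n
  (E ∪ F) i j = E i j ∨ F i j
  (E ∖ F) i j = E i j ∧ not (F i j)

  ⋃ : (Fin n → EdgeSet n) → EdgeSet n
  ⋃ P i j = any (λ v → P v i j) (allFin n)

  -- the edges whose smaller endpoint lies in S
  restrict : (Fin n → Bool) → EdgeSet n → EdgeSet n
  restrict S E i j = S i ∧ E i j

  link : Fin n → Fin n → EdgeSet n
  link x y i j = (⌊ x ≟ i ⌋ ∧ ⌊ y ≟ j ⌋) ∨ (⌊ x ≟ j ⌋ ∧ ⌊ y ≟ i ⌋)

  ordered-irrefl : ∀ i → ordered i i ≡ false
  ordered-irrefl i with ordered i i in o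
  ... | true  = ⊥-elim (<-irrefl refl (ordered⇒< {i} {i} o))
  ... | false = refl

  link-backward : ∀ {x y} → toℕ x < toℕ y → ∀ i j → ordered i j ∧ (⌊ x ≟ j ⌋ ∧ ⌊ y ≟ i ⌋) ≡ false
  link-backward {x} {y} x<y i j with x ≟ j | y ≟ i
  ... | yes refl | yes refl with ordered y x in o
  ...   | true  = ⊥-elim (<-asym x<y (ordered⇒< {y} {x} o))
  ...   | false = refl
  link-backward x<y i j | yes _ | no _ = ∧-zeroʳ (ordered i j)
  link-backward x<y i j | no _  | _    = ∧-zeroʳ (ordered i j)

  link-sym : ∀ x y i j → link x y i j ≡ link y x i j
  link-sym x y i j =
    trans (∨-comm (⌊ x ≟ i ⌋ ∧ ⌊ y ≟ j ⌋) _) (cong₂ _∨_ (∧-comm ⌊ x ≟ j ⌋ _) (∧-comm ⌊ x ≟ i ⌋ _))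

  Walk-trans : ∀ {E : EdgeSet n} {i j k} → Walk E i j → Walk E j k → Walk E i k
  Walk-trans here        w′ = w′
  Walk-trans (step e w) w′ = step e (Walk-trans w w′)

  Walk-sym : ∀ {E : EdgeSet n} {i j} → Walk E i j → Walk E j i
  Walk-sym here = here
  Walk-sym {E} {i} (step {j = j} e w) =
    Walk-trans (Walk-sym w) (step (trans (edge-sym E j i) e) here)

  Walk-isEquivalence : ∀ (E : EdgeSet n) → IsEquivalence (Walk E)
  Walk-isEquivalence E = record { refl = here ; sym = Walk-sym ; trans = Walk-trans }

  Walk-preserves : ∀ {E : EdgeSet n} {P : Fin n → Set} →
                   (∀ i j → edge E i j ≡ true → P i → P j) →
                   ∀ {i j} → Walk E i j → P i → P j
  Walk-preserves closed here               p = p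
  Walk-preserves closed (step {i} {j} e w) p = Walk-preserves closed w (closed i j e p)

  Steps-mono : ∀ {E F : EdgeSet n} → E ⊆ᴱ F → ∀ l → Steps E l → Steps F l
  Steps-mono E⊆F []          _       = tt
  Steps-mono E⊆F (x ∷ [])    _       = tt
  Steps-mono E⊆F (x ∷ y ∷ l) (e , s) = ⊆ᴱ-edge E⊆F x y e , Steps-mono E⊆F (y ∷ l) s

  HasCycle-mono : ∀ {E F : EdgeSet n} → E ⊆ᴱ F → HasCycle E → HasCycle F
  HasCycle-mono E⊆F (x , l , long , distinct , steps) =
    x , l , long , distinct , Steps-mono E⊆F (x ∷ (l ++ x ∷ [])) steps

  ≟-sound : ∀ {x y : Fin n} → ⌊ x ≟ y ⌋ ≡ true → x ≡ y
  ≟-sound e = toWitness (Equivalence.from T-≡ e)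

  ≟-complete : ∀ {x y : Fin n} → x ≡ y → ⌊ x ≟ y ⌋ ≡ true
  ≟-complete x≡y = Equivalence.to T-≡ (fromWitness x≡y)

  link-∈ : ∀ {x y i j} l → link x y i j ≡ true → i ∈ x ∷ y ∷ l × j ∈ x ∷ y ∷ l
  link-∈ {x} {y} {i} l e with ∨-true {⌊ x ≟ i ⌋ ∧ _} e
  ... | inj₁ e′ = let (x≡i , y≡j) = ∧-true e′ in
    here (sym (≟-sound x≡i)) , there (here (sym (≟-sound y≡j)))
  ... | inj₂ e′ = let (x≡j , y≡i) = ∧-true e′ in
    there (here (sym (≟-sound y≡i))) , here (sym (≟-sound x≡j))

  pathEdges-∈ : ∀ l {i j} → pathEdges l i j ≡ true → i ∈ l × j ∈ l
  pathEdges-∈ []          ()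
  pathEdges-∈ (x ∷ [])    ()
  pathEdges-∈ (x ∷ y ∷ l) {i} {j} e =
    [ link-∈ l , Product.map there there ∘ pathEdges-∈ (y ∷ l) ]′
      (∨-true (trans (∨-assoc (⌊ x ≟ i ⌋ ∧ ⌊ y ≟ j ⌋) _ _) e))

  edge-pathEdges-∈ : ∀ l i j → edge (pathEdges l) i j ≡ true → i ∈ l × j ∈ l
  edge-pathEdges-∈ l i j with ordered i j | ordered j i
  ... | true  | _     = pathEdges-∈ l
  ... | false | true  = Product.swap ∘ pathEdges-∈ l
  ... | false | false = λ ()

  traversals-∈ : ∀ l {i j} → ¬ traversals l i j ≡ 0 → i ∈ l × j ∈ l
  traversals-∈ []          t≢0 = ⊥-elim (t≢0 refl)
  traversals-∈ (x ∷ [])    t≢0 = ⊥-elim (t≢0 refl)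
  traversals-∈ (x ∷ y ∷ l) {i} {j} t≢0 with link x y i j in e | traversals-∈ (y ∷ l) {i} {j}
  ... | true  | _  = link-∈ l e
  ... | false | ih = Product.map there there (ih t≢0)

module _ {n : ℕ} {E : EdgeSet n} {S : Fin n → Bool} where

  restrict-⊆ : restrict S E ⊆ᴱ E
  restrict-⊆ {i} _ e = proj₂ (∧-true {a = S i} e)

  edge-restrict⁻ : ∀ i j → edge (restrict S E) i j ≡ true → (S i ≡ true ⊎ S j ≡ true)
  edge-restrict⁻ i j with ordered i j | ordered j i
  ... | true  | _     = λ e → inj₁ (proj₁ (∧-true {a = S i} e))
  ... | false | true  = λ e → inj₂ (proj₁ (∧-true {a = S j} e))
  ... | false | false = λ ()

  edge-restrict⁺ : ∀ {i j} → S i ≡ true → S j ≡ true → edge E i j ≡ true →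
                   edge (restrict S E) i j ≡ true
  edge-restrict⁺ {i} {j} Sᵢ Sⱼ with ordered i j | ordered j i
  ... | true  | _     = λ e → trans (cong (_∧ E i j) Sᵢ) e
  ... | false | true  = λ e → trans (cong (_∧ E j i) Sⱼ) e
  ... | false | false = λ ()

  component-spanningTree : ∀ {u} → (HasCycle E → ⊥) →
    (∀ i → S i ≡ true → Walk E u i) → (∀ i → Walk E u i → S i ≡ true) →
    SpanningTreeOn (Walk E u) (restrict S E)
  component-spanningTree {u} acyclic S⇒U U⇒S = inside , connected , acyclic ∘ HasCycle-mono restrict-⊆
    where
    extend : ∀ {i j} → Walk E u i → edge E i j ≡ true → Walk E u j
    extend uᵢ e = Walk-trans uᵢ (step e here)

    inside : ∀ i j → edge (restrict S E) i j ≡ true → Walk E u i × Walk E u j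
    inside i j e with edge-restrict⁻ i j e
    ... | inj₁ Sᵢ = S⇒U i Sᵢ , extend (S⇒U i Sᵢ) (⊆ᴱ-edge restrict-⊆ i j e)
    ... | inj₂ Sⱼ =
      extend (S⇒U j Sⱼ) (⊆ᴱ-edge restrict-⊆ j i (trans (edge-sym (restrict S E) j i) e)) , S⇒U j Sⱼ

    lift : ∀ {i j} → Walk E u i → Walk E i j → Walk (restrict S E) i j
    lift uᵢ here = here
    lift uᵢ (step {j = k} e w) =
      step (edge-restrict⁺ (U⇒S _ uᵢ) (U⇒S k (extend uᵢ e)) e) (lift (extend uᵢ e) w)

    connected : ∀ i j → Walk E u i → Walk E u j → Walk (restrict S E) i j
    connected i j uᵢ uⱼ = lift uᵢ (Walk-trans (Walk-sym uᵢ) uⱼ)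

module CanonicalRepresentative {a ℓ} {X : Set a} {_∼_ : Rel X ℓ}
  (∼-isEquivalence : IsEquivalence _∼_) (_∼?_ : Decidable _∼_)
  (xs : List X) (enumerates : ∀ x → x ∈ xs) where
  open IsEquivalence ∼-isEquivalence renaming (refl to ∼-refl; sym to ∼-sym; trans to ∼-trans)

  firstRelated : X → List X → X
  firstRelated x []       = x
  firstRelated x (y ∷ ys) = if does (x ∼? y) then y else firstRelated x ys

  firstRelated-∼ : ∀ x ys → x ∼ firstRelated x ys
  firstRelated-∼ x []       = ∼-refl
  firstRelated-∼ x (y ∷ ys) with x ∼? y
  ... | yes x∼y = x∼y
  ... | no  _   = firstRelated-∼ x ys

  firstRelated-cong : ∀ {x x′ z ys} → x ∼ x′ → z ∈ ys → x ∼ z →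
                      firstRelated x ys ≡ firstRelated x′ ys
  firstRelated-cong {x} {x′} {ys = y ∷ ys} x∼x′ z∈ x∼z with x ∼? y | x′ ∼? y
  ... | yes _   | yes _     = refl
  ... | yes x∼y | no ¬x′∼y = ⊥-elim (¬x′∼y (∼-trans (∼-sym x∼x′) x∼y))
  ... | no ¬x∼y | yes x′∼y = ⊥-elim (¬x∼y (∼-trans x∼x′ x′∼y))
  ... | no ¬x∼y | no _ with z∈
  ...   | here refl  = ⊥-elim (¬x∼y x∼z)
  ...   | there z∈ys = firstRelated-cong x∼x′ z∈ys x∼z

  rep : X → X
  rep x = firstRelated x xs

  rep-∼ : ∀ x → x ∼ rep x
  rep-∼ x = firstRelated-∼ x xs

  rep-cong : ∀ {x y} → x ∼ y → rep x ≡ rep y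
  rep-cong {x} x∼y = firstRelated-cong x∼y (enumerates x) ∼-refl

module _ {a} {X : Set a} (_≟ˣ_ : DecidableEquality X) where

  deduplicate-⊆ : ∀ (xs : List X) → deduplicate _≟ˣ_ xs ⊆ xs
  deduplicate-⊆ []       = []
  deduplicate-⊆ (x ∷ xs) =
    refl ∷ ⊆-trans (filter-⊆ (¬? ∘ (x ≟ˣ_)) (deduplicate _≟ˣ_ xs)) (deduplicate-⊆ xs)

  ⊆-snoc⁻ : ∀ {x : X} {s} (l : List X) → s ⊆ l ∷ᴸ x → All (λ z → ¬ x ≡ z) s → s ⊆ l
  ⊆-snoc⁻ []      (_ ∷ʳ [])    _            = []
  ⊆-snoc⁻ []      (refl ∷ _)   (x≢x ∷ _)    = ⊥-elim (x≢x refl)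
  ⊆-snoc⁻ (y ∷ l) (.y ∷ʳ s⊆l)  avoids       = y ∷ʳ ⊆-snoc⁻ l s⊆l avoids
  ⊆-snoc⁻ (y ∷ l) (refl ∷ s⊆l) (_ ∷ avoids) = refl ∷ ⊆-snoc⁻ l s⊆l avoids

module WeightProperties {c ℓ} (A : OrderedCommMonoid c ℓ) {n : ℕ} where
  open OrderedCommMonoid A
  open OrderedCommMonoidProperties A

  sum² : (Fin n → Fin n → Carrier) → Carrier
  sum² f = sum (λ i → sum (λ j → f i j))

  sum²-cong : ∀ {f g} → (∀ i j → f i j ≡ g i j) → sum² f ≡ sum² g
  sum²-cong f≡g = sum-cong-≗ (λ i → sum-cong-≗ (f≡g i))

  sum²-mono-≤ : ∀ {f g} → (∀ i j → f i j ≤ g i j) → sum² f ≤ sum² g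
  sum²-mono-≤ f≤g = ∑-mono-≤ (λ i → ∑-mono-≤ (f≤g i))

  sum²-distrib-+ : ∀ f g → sum² (λ i j → f i j + g i j) ≡ sum² f + sum² g
  sum²-distrib-+ f g =
    trans (sum-cong-≗ (λ i → ∑-distrib-+ (f i) (g i))) (∑-distrib-+ (sum ∘ f) (sum ∘ g))

  sum²-zero : sum² (λ _ _ → 0#) ≡ 0#
  sum²-zero = trans (sum-cong-≗ {n} (λ _ → sum-replicate-zero n)) (sum-replicate-zero n)

  sum²-δ : ∀ x y v → sum² (λ i j → when (⌊ x ≟ i ⌋ ∧ ⌊ y ≟ j ⌋) v) ≡ v
  sum²-δ x y v = trans (sum-cong-≗ row) (∑-δ x v)
    where
    row : ∀ i → sum (λ j → when (⌊ x ≟ i ⌋ ∧ ⌊ y ≟ j ⌋) v) ≡ when ⌊ x ≟ i ⌋ v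
    row i = trans (sum-cong-≗ {n} (λ j → trans (when-∧ ⌊ x ≟ i ⌋ _ v) (when-comm ⌊ x ≟ i ⌋ _ v)))
                  (∑-δ y (when ⌊ x ≟ i ⌋ v))

  NonNegative : Dist A n → Set ℓ
  NonNegative d = ∀ i j → 0# ≤ d i j

  edgeWeight : Dist A n → EdgeSet n → Fin n → Fin n → Carrier
  edgeWeight d E i j = when (ordered i j ∧ E i j) (d i j)

  weight-sum² : ∀ d E → weight A d E ≡ sum² (edgeWeight d E)
  weight-sum² d E = begin-equality
    weight A d E
      ≡⟨ sumL-cartesianProduct (λ p → edgeWeight d E (proj₁ p) (proj₂ p)) (allFin n) (allFin n) ⟩
    sumL (map (λ i → sumL (map (λ j → edgeWeight d E i j) (allFin n))) (allFin n))
      ≡⟨ sumL-allFin (λ i → sumL (map (edgeWeight d E i) (allFin n))) ⟩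
    sum (λ i → sumL (map (λ j → edgeWeight d E i j) (allFin n)))
      ≡⟨ sum-cong-≗ (λ i → sumL-allFin (edgeWeight d E i)) ⟩
    sum² (edgeWeight d E) ∎

  weight-pointwise : ∀ {d d′ E F} → (∀ i j → edgeWeight d E i j ≡ edgeWeight d′ F i j) →
                     weight A d E ≡ weight A d′ F
  weight-pointwise {d} {d′} {E} {F} eq =
    trans (weight-sum² d E) (trans (sum²-cong eq) (sym (weight-sum² d′ F)))

  weight-pointwise-≤ : ∀ {d d′ E F} → (∀ i j → edgeWeight d E i j ≤ edgeWeight d′ F i j) →
                       weight A d E ≤ weight A d′ F
  weight-pointwise-≤ {d} {d′} {E} {F} le = begin
    weight A d E           ≡⟨ weight-sum² d E ⟩
    sum² (edgeWeight d E)  ≤⟨ sum²-mono-≤ le ⟩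
    sum² (edgeWeight d′ F) ≡⟨ weight-sum² d′ F ⟨
    weight A d′ F          ∎

  weight-≗ : ∀ d {E F} → (∀ i j → E i j ≡ F i j) → weight A d E ≡ weight A d F
  weight-≗ d E≗F = weight-pointwise (λ i j → cong (λ b → when (ordered i j ∧ b) (d i j)) (E≗F i j))

  weight-cong : ∀ d {E F} → (∀ i j → edge E i j ≡ edge F i j) → weight A d E ≡ weight A d F
  weight-cong d {E} {F} E≡F = weight-pointwise pointwise
    where
    pointwise : ∀ i j → edgeWeight d E i j ≡ edgeWeight d F i j
    pointwise i j with ordered i j in o
    ... | false = refl
    ... | true  = cong (λ b → when b (d i j))
                       (trans (sym (edge-ordered E o)) (trans (E≡F i j) (edge-ordered F o)))

  weight-nonneg : ∀ {d} E → NonNegative d → 0# ≤ weight A d E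
  weight-nonneg {d} E d≥0 = ≤-trans (∑-nonneg (λ i → ∑-nonneg (λ j → when-nonneg _ (d≥0 i j))))
                                     (≤-reflexive (sym (weight-sum² d E)))

  weight-∅ : ∀ d → weight A d (λ _ _ → false) ≡ 0#
  weight-∅ d = begin-equality
    weight A d (λ _ _ → false)          ≡⟨ weight-sum² d (λ _ _ → false) ⟩
    sum² (edgeWeight d (λ _ _ → false))
      ≡⟨ sum²-cong (λ i j → cong (λ b → when b (d i j)) (∧-zeroʳ (ordered i j))) ⟩
    sum² (λ _ _ → 0#)                   ≡⟨ sum²-zero ⟩
    0#                                  ∎

  weight-mono : ∀ {d E F} → NonNegative d → E ⊆ᴱ F → weight A d E ≤ weight A d F
  weight-mono {d} {E} {F} d≥0 E⊆F = weight-pointwise-≤ pointwise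
    where
    pointwise : ∀ i j → edgeWeight d E i j ≤ edgeWeight d F i j
    pointwise i j with ordered i j in o | E i j in e
    ... | false | _     = ≤-refl
    ... | true  | false = when-nonneg (F i j) (d≥0 i j)
    ... | true  | true  rewrite E⊆F o e = ≤-refl

  weight-pointwise-+ : ∀ {d d₁ d₂ E E₁ E₂} →
    (∀ i j → edgeWeight d E i j ≡ edgeWeight d₁ E₁ i j + edgeWeight d₂ E₂ i j) →
    weight A d E ≡ weight A d₁ E₁ + weight A d₂ E₂
  weight-pointwise-+ {d} {d₁} {d₂} {E} {E₁} {E₂} eq = begin-equality
    weight A d E                                        ≡⟨ weight-sum² d E ⟩
    sum² (edgeWeight d E)                               ≡⟨ sum²-cong eq ⟩
    sum² (λ i j → edgeWeight d₁ E₁ i j + edgeWeight d₂ E₂ i j)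
      ≡⟨ sum²-distrib-+ (edgeWeight d₁ E₁) (edgeWeight d₂ E₂) ⟩
    sum² (edgeWeight d₁ E₁) + sum² (edgeWeight d₂ E₂)
      ≡⟨ cong₂ _+_ (weight-sum² d₁ E₁) (weight-sum² d₂ E₂) ⟨
    weight A d₁ E₁ + weight A d₂ E₂                     ∎

  weight-∪ : ∀ {d} E F → NonNegative d → weight A d (E ∪ F) ≤ weight A d E + weight A d F
  weight-∪ {d} E F d≥0 = begin
    weight A d (E ∪ F)                                  ≡⟨ weight-sum² d (E ∪ F) ⟩
    sum² (edgeWeight d (E ∪ F))                         ≤⟨ sum²-mono-≤ pointwise ⟩
    sum² (λ i j → edgeWeight d E i j + edgeWeight d F i j)
      ≡⟨ sum²-distrib-+ (edgeWeight d E) (edgeWeight d F) ⟩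
    sum² (edgeWeight d E) + sum² (edgeWeight d F)       ≡⟨ cong₂ _+_ (weight-sum² d E) (weight-sum² d F) ⟨
    weight A d E + weight A d F                         ∎
    where
    pointwise : ∀ i j → edgeWeight d (E ∪ F) i j ≤ edgeWeight d E i j + edgeWeight d F i j
    pointwise i j with ordered i j | E i j
    ... | false | _     = ≤-reflexive (sym (+-identityˡ 0#))
    ... | true  | true  = x≤x+y (when-nonneg (F i j) (d≥0 i j))
    ... | true  | false = ≤-reflexive (sym (+-identityˡ _))

  weight-∖ : ∀ d {E F} → F ⊆ᴱ E → weight A d E ≡ weight A d (E ∖ F) + weight A d F
  weight-∖ d {E} {F} F⊆E = weight-pointwise-+ pointwise
    where
    pointwise : ∀ i j → edgeWeight d E i j ≡ edgeWeight d (E ∖ F) i j + edgeWeight d F i j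
    pointwise i j with ordered i j in o | E i j in e | F i j in f
    ... | false | _     | _     = sym (+-identityˡ 0#)
    ... | true  | true  | true  = sym (+-identityˡ _)
    ... | true  | true  | false = sym (+-identityʳ _)
    ... | true  | false | false = sym (+-identityˡ 0#)
    ... | true  | false | true  with () ← trans (sym e) (F⊆E o f)

  weight-⊕ : ∀ d d′ E → weight A (_⊕_ A d d′) E ≡ weight A d E + weight A d′ E
  weight-⊕ d d′ E = weight-pointwise-+ (λ i j → when-+ (ordered i j ∧ E i j) (d i j) (d′ i j))

  weight-partition : ∀ d E (label : Fin n → Fin n) →
    weight A d E ≡ sum (λ u → weight A d (restrict (λ i → ⌊ label i ≟ u ⌋) E))
  weight-partition d E label = begin-equality
    weight A d E
      ≡⟨ weight-sum² d E ⟩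
    sum² (edgeWeight d E)
      ≡⟨ sum²-cong (λ i j → ∑-δ (label i) (edgeWeight d E i j)) ⟨
    sum (λ i → sum (λ j → sum (λ u → labelled u i j)))
      ≡⟨ sum-cong-≗ (λ i → ∑-comm (λ j u → labelled u i j)) ⟩
    sum (λ i → sum (λ u → sum (λ j → labelled u i j)))
      ≡⟨ ∑-comm (λ i u → sum (λ j → labelled u i j)) ⟩
    sum (λ u → sum² (labelled u))
      ≡⟨ sum-cong-≗ (λ u → trans (sum²-cong (restrict-pointwise u)) (sym (weight-sum² d _))) ⟩
    sum (λ u → weight A d (restrict (λ i → ⌊ label i ≟ u ⌋) E)) ∎
    where
    labelled : Fin n → Fin n → Fin n → Carrier
    labelled u i j = when ⌊ label i ≟ u ⌋ (edgeWeight d E i j)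

    restrict-pointwise : ∀ u i j →
      labelled u i j ≡ edgeWeight d (restrict (λ i → ⌊ label i ≟ u ⌋) E) i j
    restrict-pointwise u i j with ordered i j | ⌊ label i ≟ u ⌋
    ... | true  | true  = refl
    ... | true  | false = refl
    ... | false | true  = refl
    ... | false | false = refl

  RSTcost-split : ∀ d₁ d₂ {T₁ T₂ H} → H ⊆ᴱ T₁ → H ⊆ᴱ T₂ →
    RSTcost A d₁ d₂ T₁ T₂ ≡ (weight A d₁ (T₁ ∖ H) + weight A d₂ (T₂ ∖ H)) + weight A (_⊕_ A d₁ d₂) H
  RSTcost-split d₁ d₂ {T₁} {T₂} {H} H⊆T₁ H⊆T₂ = begin-equality
    weight A d₁ T₁ + weight A d₂ T₂
      ≡⟨ cong₂ _+_ (weight-∖ d₁ H⊆T₁) (weight-∖ d₂ H⊆T₂) ⟩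
    (weight A d₁ (T₁ ∖ H) + weight A d₁ H) + (weight A d₂ (T₂ ∖ H) + weight A d₂ H)
      ≡⟨ interchange _ _ _ _ ⟩
    (weight A d₁ (T₁ ∖ H) + weight A d₂ (T₂ ∖ H)) + (weight A d₁ H + weight A d₂ H)
      ≡⟨ cong ((weight A d₁ (T₁ ∖ H) + weight A d₂ (T₂ ∖ H)) +_) (weight-⊕ d₁ d₂ H) ⟨
    (weight A d₁ (T₁ ∖ H) + weight A d₂ (T₂ ∖ H)) + weight A (_⊕_ A d₁ d₂) H ∎

  RSTcost-replaceEdges : ∀ {d₁ d₂} T₁ T₂ H P → NonNegative d₁ → NonNegative d₂ →
    RSTcost A d₁ d₂ (replaceEdges T₁ H P) (replaceEdges T₂ H P)
      ≤ (weight A d₁ (T₁ ∖ H) + weight A d₂ (T₂ ∖ H)) + weight A (_⊕_ A d₁ d₂) (⋃ P)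
  RSTcost-replaceEdges {d₁} {d₂} T₁ T₂ H P d₁≥0 d₂≥0 = begin
    weight A d₁ ((T₁ ∖ H) ∪ ⋃ P) + weight A d₂ ((T₂ ∖ H) ∪ ⋃ P)
      ≤⟨ +-mono-≤ (weight-∪ (T₁ ∖ H) (⋃ P) d₁≥0) (weight-∪ (T₂ ∖ H) (⋃ P) d₂≥0) ⟩
    (weight A d₁ (T₁ ∖ H) + weight A d₁ (⋃ P)) + (weight A d₂ (T₂ ∖ H) + weight A d₂ (⋃ P))
      ≡⟨ interchange _ _ _ _ ⟩
    (weight A d₁ (T₁ ∖ H) + weight A d₂ (T₂ ∖ H)) + (weight A d₁ (⋃ P) + weight A d₂ (⋃ P))
      ≡⟨ cong ((weight A d₁ (T₁ ∖ H) + weight A d₂ (T₂ ∖ H)) +_) (weight-⊕ d₁ d₂ (⋃ P)) ⟨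
    (weight A d₁ (T₁ ∖ H) + weight A d₂ (T₂ ∖ H)) + weight A (_⊕_ A d₁ d₂) (⋃ P) ∎

module PathCost {c ℓ} (A : OrderedCommMonoid c ℓ) {n : ℕ} (w : Dist A n) (metric : Metric A w) where
  open OrderedCommMonoid A
  open OrderedCommMonoidProperties A
  open WeightProperties A {n}
  open Metric metric renaming (sym to w-sym)

  pathCost : List (Fin n) → Carrier
  pathCost []          = 0#
  pathCost (x ∷ [])    = 0#
  pathCost (x ∷ y ∷ l) = w x y + pathCost (y ∷ l)

  pathCost-∷ : ∀ z l → pathCost l ≤ pathCost (z ∷ l)
  pathCost-∷ z []      = ≤-refl
  pathCost-∷ z (y ∷ l) = x≤y+x (nonneg z y)

  pathCost-++ : ∀ xs ys → pathCost xs + pathCost ys ≤ pathCost (xs ++ ys)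
  pathCost-++ []           ys = ≤-reflexive (+-identityˡ (pathCost ys))
  pathCost-++ (x ∷ [])     ys = ≤-trans (≤-reflexive (+-identityˡ (pathCost ys))) (pathCost-∷ x ys)
  pathCost-++ (x ∷ y ∷ xs) ys = begin
    (w x y + pathCost (y ∷ xs)) + pathCost ys ≡⟨ +-assoc (w x y) (pathCost (y ∷ xs)) (pathCost ys) ⟩
    w x y + (pathCost (y ∷ xs) + pathCost ys) ≤⟨ +-monoʳ-≤ (w x y) (pathCost-++ (y ∷ xs) ys) ⟩
    w x y + pathCost (y ∷ xs ++ ys)           ∎

  pathCost-∷ᴸ : ∀ l z → pathCost l ≤ pathCost (l ∷ᴸ z)
  pathCost-∷ᴸ l z = ≤-trans (≤-reflexive (sym (+-identityʳ (pathCost l)))) (pathCost-++ l (z ∷ []))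

  pathCost-join : ∀ xs y ys → pathCost (xs ++ y ∷ ys) ≡ pathCost (xs ∷ᴸ y) + pathCost (y ∷ ys)
  pathCost-join []            y ys = sym (+-identityˡ (pathCost (y ∷ ys)))
  pathCost-join (x ∷ [])      y ys = cong (_+ pathCost (y ∷ ys)) (sym (+-identityʳ (w x y)))
  pathCost-join (x ∷ x′ ∷ xs) y ys = begin-equality
    w x x′ + pathCost (x′ ∷ xs ++ y ∷ ys)                 ≡⟨ cong (w x x′ +_) (pathCost-join (x′ ∷ xs) y ys) ⟩
    w x x′ + (pathCost (x′ ∷ xs ∷ᴸ y) + pathCost (y ∷ ys)) ≡⟨ +-assoc (w x x′) _ _ ⟨
    (w x x′ + pathCost (x′ ∷ xs ∷ᴸ y)) + pathCost (y ∷ ys) ∎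

  pathCost-detour : ∀ h z l → pathCost (h ∷ l) ≤ w h z + pathCost (z ∷ l)
  pathCost-detour h z []      = ≤-trans (nonneg h z) (≤-reflexive (sym (+-identityʳ (w h z))))
  pathCost-detour h z (y ∷ l) = begin
    w h y + pathCost (y ∷ l)           ≤⟨ +-monoˡ-≤ (pathCost (y ∷ l)) (triangle h z y) ⟩
    (w h z + w z y) + pathCost (y ∷ l) ≡⟨ +-assoc (w h z) (w z y) (pathCost (y ∷ l)) ⟩
    w h z + (w z y + pathCost (y ∷ l)) ∎

  pathCost-shortcut : ∀ h y {s l} → s ⊆ l → pathCost (h ∷ s ∷ᴸ y) ≤ pathCost (h ∷ l ∷ᴸ y)
  pathCost-shortcut h y []                = ≤-refl
  pathCost-shortcut h y (_∷ʳ_ {ys = l} z s⊆l) =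
    ≤-trans (pathCost-shortcut h y s⊆l) (pathCost-detour h z (l ∷ᴸ y))
  pathCost-shortcut h y (_∷_ {x = z} refl s⊆l) = +-monoʳ-≤ (w h z) (pathCost-shortcut z y s⊆l)

  -- b ++ a is the tour x ∷ D ∷ᴸ x with its edge from the last vertex of a to the first of b deleted.
  pathCost-open : ∀ x D a b → x ∷ D ≡ a ++ b → pathCost (b ++ a) ≤ pathCost (x ∷ D ∷ᴸ x)
  pathCost-open x D [] .(x ∷ D) refl = begin
    pathCost ((x ∷ D) ++ []) ≡⟨ cong pathCost (++-identityʳ (x ∷ D)) ⟩
    pathCost (x ∷ D)         ≤⟨ pathCost-∷ᴸ (x ∷ D) x ⟩
    pathCost (x ∷ D ∷ᴸ x)    ∎
  pathCost-open x .(a ++ b) (.x ∷ a) b refl = begin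
    pathCost (b ++ x ∷ a)                ≡⟨ pathCost-join b x a ⟩
    pathCost (b ∷ᴸ x) + pathCost (x ∷ a) ≡⟨ +-comm (pathCost (b ∷ᴸ x)) (pathCost (x ∷ a)) ⟩
    pathCost (x ∷ a) + pathCost (b ∷ᴸ x) ≤⟨ pathCost-++ (x ∷ a) (b ∷ᴸ x) ⟩
    pathCost (x ∷ a ++ b ∷ᴸ x)           ≡⟨ cong (pathCost ∘ (x ∷_)) (++-assoc a b (x ∷ [])) ⟨
    pathCost (x ∷ (a ++ b) ∷ᴸ x)         ∎

  pathCost-deduplicate : ∀ x r → (r ≡ [] ⊎ Σ (List (Fin n)) λ r′ → r ≡ r′ ∷ᴸ x) →
    pathCost (x ∷ filter (¬? ∘ (x ≟_)) (deduplicate _≟_ r) ∷ᴸ x) ≤ pathCost (x ∷ r)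
  pathCost-deduplicate x .[] (inj₁ refl) = ≤-reflexive (trans (+-identityʳ (w x x)) (self x))
  pathCost-deduplicate x .(r′ ∷ᴸ x) (inj₂ (r′ , refl)) =
    pathCost-shortcut x x (⊆-snoc⁻ _≟_ r′ D⊆r′∷ᴸx (all-filter (¬? ∘ (x ≟_)) dedup))
    where
    dedup : List (Fin n)
    dedup = deduplicate _≟_ (r′ ∷ᴸ x)

    D⊆r′∷ᴸx : filter (¬? ∘ (x ≟_)) dedup ⊆ r′ ∷ᴸ x
    D⊆r′∷ᴸx = ⊆-trans (filter-⊆ (¬? ∘ (x ≟_)) dedup) (deduplicate-⊆ _≟_ (r′ ∷ᴸ x))

  link-loop : ∀ x i j → edgeWeight w (link x x) i j ≡ 0#
  link-loop x i j with x ≟ i | x ≟ j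
  ... | yes refl | yes refl = cong (λ b → when (b ∧ true) (w x x)) (ordered-irrefl x)
  ... | yes _    | no _     = cong (λ b → when b (w i j)) (∧-zeroʳ (ordered i j))
  ... | no _     | yes _    = cong (λ b → when b (w i j)) (∧-zeroʳ (ordered i j))
  ... | no _     | no _     = cong (λ b → when b (w i j)) (∧-zeroʳ (ordered i j))

  link-forward : ∀ {x y} → toℕ x < toℕ y →
    ∀ i j → edgeWeight w (link x y) i j ≡ when (⌊ x ≟ i ⌋ ∧ ⌊ y ≟ j ⌋) (w x y)
  link-forward {x} {y} x<y i j with x ≟ i | y ≟ j
  ... | yes refl | yes refl = cong (λ b → when (b ∧ true) (w x y)) (<⇒ordered x<y)
  ... | yes _    | no _     = cong (λ b → when b (w i j)) (link-backward x<y i j)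
  ... | no _     | _        = cong (λ b → when b (w i j)) (link-backward x<y i j)

  weight-link-< : ∀ {x y} → toℕ x < toℕ y → weight A w (link x y) ≡ w x y
  weight-link-< {x} {y} x<y = begin-equality
    weight A w (link x y)                              ≡⟨ weight-sum² w (link x y) ⟩
    sum² (edgeWeight w (link x y))                     ≡⟨ sum²-cong (link-forward x<y) ⟩
    sum² (λ i j → when (⌊ x ≟ i ⌋ ∧ ⌊ y ≟ j ⌋) (w x y)) ≡⟨ sum²-δ x y (w x y) ⟩
    w x y                                              ∎

  weight-link : ∀ x y → weight A w (link x y) ≡ w x y
  weight-link x y with <-cmp (toℕ x) (toℕ y)
  ... | tri< x<y _ _ = weight-link-< x<y
  ... | tri> _ _ y<x = begin-equality
    weight A w (link x y) ≡⟨ weight-≗ w (link-sym x y) ⟩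
    weight A w (link y x) ≡⟨ weight-link-< y<x ⟩
    w y x                 ≡⟨ w-sym y x ⟩
    w x y                 ∎
  ... | tri≈ _ x≡y _ with toℕ-injective x≡y
  ...   | refl = begin-equality
    weight A w (link x x)          ≡⟨ weight-sum² w (link x x) ⟩
    sum² (edgeWeight w (link x x)) ≡⟨ sum²-cong (link-loop x) ⟩
    sum² (λ _ _ → 0#)              ≡⟨ sum²-zero ⟩
    0#                             ≡⟨ self x ⟨
    w x x                          ∎

  weight-pathEdges : ∀ l → weight A w (pathEdges l) ≤ pathCost l
  weight-pathEdges []          = ≤-reflexive (weight-∅ w)
  weight-pathEdges (x ∷ [])    = ≤-reflexive (weight-∅ w)
  weight-pathEdges (x ∷ y ∷ l) = begin
    weight A w (pathEdges (x ∷ y ∷ l))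
      ≡⟨ weight-≗ w (λ i j → sym (∨-assoc (⌊ x ≟ i ⌋ ∧ ⌊ y ≟ j ⌋) _ _)) ⟩
    weight A w (link x y ∪ pathEdges (y ∷ l))
      ≤⟨ weight-∪ (link x y) (pathEdges (y ∷ l)) nonneg ⟩
    weight A w (link x y) + weight A w (pathEdges (y ∷ l))
      ≤⟨ +-mono-≤ (≤-reflexive (weight-link x y)) (weight-pathEdges (y ∷ l)) ⟩
    w x y + pathCost (y ∷ l) ∎

  pathCost-traversals : ∀ l → pathCost l ≡ sum² (λ i j → when (ordered i j) (traversals l i j · w i j))
  pathCost-traversals []          = sym (trans (sum²-cong (λ i j → when-0# (ordered i j))) sum²-zero)
  pathCost-traversals (x ∷ [])    = sym (trans (sum²-cong (λ i j → when-0# (ordered i j))) sum²-zero)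
  pathCost-traversals (x ∷ y ∷ l) = begin-equality
    w x y + pathCost (y ∷ l)
      ≡⟨ cong₂ _+_ (trans (sym (weight-link x y)) (weight-sum² w (link x y)))
                   (pathCost-traversals (y ∷ l)) ⟩
    sum² (edgeWeight w (link x y)) + sum² (λ i j → when (ordered i j) (traversals (y ∷ l) i j · w i j))
      ≡⟨ sum²-distrib-+ _ _ ⟨
    sum² (λ i j → edgeWeight w (link x y) i j + when (ordered i j) (traversals (y ∷ l) i j · w i j))
      ≡⟨ sum²-cong one-more-step ⟩
    sum² (λ i j → when (ordered i j) (traversals (x ∷ y ∷ l) i j · w i j)) ∎
    where
    one-more-step : ∀ i j → edgeWeight w (link x y) i j + when (ordered i j) (traversals (y ∷ l) i j · w i j)
                          ≡ when (ordered i j) (traversals (x ∷ y ∷ l) i j · w i j)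
    one-more-step i j with ordered i j | link x y i j
    ... | false | _     = +-identityˡ 0#
    ... | true  | true  = refl
    ... | true  | false = +-identityˡ _

  pathCost-doubled : ∀ l (M : EdgeSet n) →
    (∀ i j → toℕ i < toℕ j → traversals l i j ≡ (if M i j then 2 else 0)) →
    pathCost l ≡ weight A w M + weight A w M
  pathCost-doubled l M twice = begin-equality
    pathCost l                                                   ≡⟨ pathCost-traversals l ⟩
    sum² (λ i j → when (ordered i j) (traversals l i j · w i j)) ≡⟨ sum²-cong doubled ⟩
    sum² (λ i j → edgeWeight w M i j + edgeWeight w M i j)       ≡⟨ sum²-distrib-+ _ _ ⟩
    sum² (edgeWeight w M) + sum² (edgeWeight w M)
      ≡⟨ cong₂ _+_ (weight-sum² w M) (weight-sum² w M) ⟨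
    weight A w M + weight A w M                                  ∎
    where
    doubled : ∀ i j → when (ordered i j) (traversals l i j · w i j) ≡ edgeWeight w M i j + edgeWeight w M i j
    doubled i j with ordered i j in o
    ... | false = sym (+-identityˡ 0#)
    ... | true rewrite twice i j (ordered⇒< o) with M i j
    ...   | true  = cong (w i j +_) (+-identityʳ (w i j))
    ...   | false = sym (+-identityˡ 0#)

  doubleTreePath-weight : ∀ {U P} → DoubleTreePath A w U P →
    ∀ T → SpanningTreeOn U T → weight A w P ≤ weight A w T + weight A w T
  doubleTreePath-weight (M , (_ , minimal) , x , r , closed , _ , _ , twice , a , b , tour , P≡path) T tree = begin
    weight A w _                    ≡⟨ weight-cong w P≡path ⟩
    weight A w (pathEdges (b ++ a)) ≤⟨ weight-pathEdges (b ++ a) ⟩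
    pathCost (b ++ a)               ≤⟨ pathCost-open x D a b tour ⟩
    pathCost (x ∷ D ∷ᴸ x)           ≤⟨ pathCost-deduplicate x r closed ⟩
    pathCost (x ∷ r)                ≡⟨ pathCost-doubled (x ∷ r) M twice ⟩
    weight A w M + weight A w M     ≤⟨ +-mono-≤ (minimal T tree) (minimal T tree) ⟩
    weight A w T + weight A w T     ∎
    where
    D : List (Fin n)
    D = filter (¬? ∘ (x ≟_)) (deduplicate _≟_ r)

module _ {c ℓ} {A : OrderedCommMonoid c ℓ} {n : ℕ} {d : Dist A n} {U : Fin n → Set} {P : EdgeSet n} where

  doubleTreePath-inside : DoubleTreePath A d U P → ∀ i j → edge P i j ≡ true → U i × U j
  doubleTreePath-inside (_ , _ , x , r , _ , inU , _ , _ , a , b , tour , P≡path) i j e =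
    Product.map fromPath fromPath (edge-pathEdges-∈ (b ++ a) i j (trans (sym (P≡path i j)) e))
    where
    fromPath : ∀ {k} → k ∈ b ++ a → U k
    fromPath {k} k∈ = All.lookup inU (∈-deduplicate⁻ _≟_ (x ∷ r) (subst (k ∈_) (sym tour) rotated))
      where
      rotated : k ∈ a ++ b
      rotated = [ ∈-++⁺ʳ a , ∈-++⁺ˡ ]′ (∈-++⁻ b k∈)

  -- The Eulerian circuit visits every vertex of U, since M spans U.
  doubleTreePath-decidable : DoubleTreePath A d U P → ∀ i → Dec (U i)
  doubleTreePath-decidable (M , ((_ , spans , _) , _) , x , r , _ , inU , _ , twice , _) i =
    map′ (All.lookup inU) covers (_∈?_ _≟_ i (x ∷ r))
    where
    traversed : ∀ a b → ordered a b ≡ true → M a b ≡ true → a ∈ x ∷ r × b ∈ x ∷ r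
    traversed a b o e = traversals-∈ (x ∷ r) λ t≡0 →
      0≢2 (trans (sym t≡0) (trans (twice a b (ordered⇒< o)) (cong (λ m → if m then 2 else 0) e)))
      where
      0≢2 : ¬ 0 ≡ 2
      0≢2 ()

    closed : ∀ a b → edge M a b ≡ true → a ∈ x ∷ r → b ∈ x ∷ r
    closed a b with ordered a b in o | ordered b a in o′
    ... | true  | _     = λ e _ → proj₂ (traversed a b o e)
    ... | false | true  = λ e _ → proj₁ (traversed b a o′ e)
    ... | false | false = λ ()

    covers : U i → i ∈ x ∷ r
    covers uᵢ = Walk-preserves closed (spans x i (All.head inU) uᵢ) (here refl)

module ComponentPaths {c ℓ} (A : OrderedCommMonoid c ℓ) {n : ℕ}
  (w : Dist A n) (metric : Metric A w) (H : EdgeSet n) (forest : HasCycle H → ⊥)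
  (P : Fin n → EdgeSet n) (P-const : ∀ v u → Walk H v u → ∀ i j → edge (P v) i j ≡ edge (P u) i j)
  (doubleTree : ∀ v → DoubleTreePath A w (Walk H v) (P v)) where
  open OrderedCommMonoid A
  open OrderedCommMonoidProperties A
  open WeightProperties A {n}
  open PathCost A w metric using (doubleTreePath-weight)
  open Metric metric using (nonneg)

  -- Components are indexed by canonical representatives; connectivity is decidable because the
  -- Eulerian circuit behind P v lists exactly the component of v.
  open CanonicalRepresentative (Walk-isEquivalence H)
    (λ u → doubleTreePath-decidable {A = A} {d = w} (doubleTree u)) (allFin n) ∈-allFin

  component : Fin n → Fin n → Bool
  component u i = ⌊ rep i ≟ u ⌋

  component⇒Walk : ∀ {u i} → component u i ≡ true → Walk H u i
  component⇒Walk {u} {i} c = Walk-sym (subst (Walk H i) (≟-sound c) (rep-∼ i))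

  Walk⇒component : ∀ {u i} → rep u ≡ u → Walk H u i → component u i ≡ true
  Walk⇒component rep≡u uᵢ = ≟-complete (trans (rep-cong (Walk-sym uᵢ)) rep≡u)

  component-rep : ∀ {u i} → component u i ≡ true → rep u ≡ u
  component-rep {u} {i} c = trans (rep-cong (component⇒Walk c)) (≟-sound c)

  ⋃-component-⊆ : ∀ u → restrict (component u) (⋃ P) ⊆ᴱ P u
  ⋃-component-⊆ u {i} {j} o e =
    trans (sym (edge-ordered (P u) o)) (trans (sym (P-const v u v~u i j)) P-edge)
    where
    witness : ∃ λ v → T (P v i j)
    witness = satisfied (any⁻ (λ v → P v i j) (allFin n)
                              (Equivalence.from T-≡ (proj₂ (∧-true {a = component u i} e))))

    v : Fin n
    v = proj₁ witness

    P-edge : edge (P v) i j ≡ true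
    P-edge = trans (edge-ordered (P v) o) (Equivalence.to T-≡ (proj₂ witness))

    v~u : Walk H v u
    v~u = Walk-trans (proj₁ (doubleTreePath-inside {A = A} {d = w} (doubleTree v) i j P-edge))
                     (Walk-sym (component⇒Walk (proj₁ (∧-true e))))

  component-weight : ∀ u → weight A w (restrict (component u) (⋃ P))
                         ≤ weight A w (restrict (component u) H) + weight A w (restrict (component u) H)
  component-weight u with rep u ≟ u
  ... | yes rep≡u = ≤-trans (weight-mono nonneg (⋃-component-⊆ u)) (doubleTreePath-weight (doubleTree u) _ tree)
    where
    tree : SpanningTreeOn (Walk H u) (restrict (component u) H)
    tree = component-spanningTree forest (λ _ → component⇒Walk) (λ _ → Walk⇒component rep≡u)
  ... | no rep≢u = ≤-trans (weight-mono nonneg empty) (x≤x+y (weight-nonneg _ nonneg))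
    where
    empty : restrict (component u) (⋃ P) ⊆ᴱ restrict (component u) H
    empty {i} _ e = ⊥-elim (rep≢u (component-rep {i = i} (proj₁ (∧-true e))))

  ⋃-weight : weight A w (⋃ P) ≤ weight A w H + weight A w H
  ⋃-weight = begin
    weight A w (⋃ P)                       ≡⟨ weight-partition w (⋃ P) rep ⟩
    sum (λ u → weight A w (Q u))           ≤⟨ ∑-mono-≤ component-weight ⟩
    sum (λ u → weight A w (K u) + weight A w (K u))
      ≡⟨ ∑-distrib-+ (λ u → weight A w (K u)) (λ u → weight A w (K u)) ⟩
    sum (λ u → weight A w (K u)) + sum (λ u → weight A w (K u))
      ≡⟨ cong₂ _+_ (weight-partition w H rep) (weight-partition w H rep) ⟨
    weight A w H + weight A w H            ∎
    where
    Q K : Fin n → EdgeSet n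
    Q u = restrict (component u) (⋃ P)
    K u = restrict (component u) H

Metric-⊕ : ∀ {c ℓ} (A : OrderedCommMonoid c ℓ) {n} {d d′ : Dist A n} →
           Metric A d → Metric A d′ → Metric A (_⊕_ A d d′)
Metric-⊕ A {d = d} {d′} m m′ = record
  { self     = λ i → trans (cong₂ _+_ (M.self i) (M′.self i)) (+-identityˡ 0#)
  ; sep      = λ i j e →
      M.sep i j (≤-antisym (≤-trans (x≤x+y (M′.nonneg i j)) (≤-reflexive e)) (M.nonneg i j))
  ; nonneg   = λ i j → ≤-trans (M.nonneg i j) (x≤x+y (M′.nonneg i j))
  ; sym      = λ i j → cong₂ _+_ (M.sym i j) (M′.sym i j)
  ; triangle = λ i j k → ≤-trans (+-mono-≤ (M.triangle i j k) (M′.triangle i j k))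
                                  (≤-reflexive (interchange (d i j) (d j k) (d′ i j) (d′ j k)))
  }
  where
  open OrderedCommMonoid A
  open OrderedCommMonoidProperties A
  module M = Metric m
  module M′ = Metric m′

lemma2 : ∀ {c ℓ : Level} (A : OrderedCommMonoid c ℓ) (n : ℕ)
    (d₁ d₂ : Dist A n) → Metric A d₁ → Metric A d₂ →
    (q : ℕ) (T₁ T₂ : EdgeSet n) → RSTOptimal A d₁ d₂ q T₁ T₂ →
    (P : Fin n → EdgeSet n) →
    (∀ v u → Walk (T₁ ∩ T₂) v u → ∀ i j → edge (P v) i j ≡ edge (P u) i j) →
    (∀ v → DoubleTreePath A (_⊕_ A d₁ d₂) (Walk (T₁ ∩ T₂) v) (P v)) →
    OrderedCommMonoid._≤_ A
    (RSTcost A d₁ d₂ (replaceEdges T₁ (T₁ ∩ T₂) P) (replaceEdges T₂ (T₁ ∩ T₂) P))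
    (OrderedCommMonoid._+_ A (RSTcost A d₁ d₂ T₁ T₂) (RSTcost A d₁ d₂ T₁ T₂))
lemma2 A n d₁ d₂ m₁ m₂ q T₁ T₂ ((T₁-tree , _ , _) , _) P P-const doubleTree = begin
  RSTcost A d₁ d₂ (replaceEdges T₁ H P) (replaceEdges T₂ H P)
    ≤⟨ RSTcost-replaceEdges T₁ T₂ H P (Metric.nonneg m₁) (Metric.nonneg m₂) ⟩
  unshared + weight A w (⋃ P)
    ≤⟨ +-monoʳ-≤ unshared ⋃-weight ⟩
  unshared + (weight A w H + weight A w H)
    ≤⟨ x+[y+y]≤[x+y]+[x+y] (weight A w H) unshared-nonneg ⟩
  (unshared + weight A w H) + (unshared + weight A w H)
    ≡⟨ cong₂ _+_ split split ⟨
  RSTcost A d₁ d₂ T₁ T₂ + RSTcost A d₁ d₂ T₁ T₂ ∎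
  where
  open OrderedCommMonoid A
  open OrderedCommMonoidProperties A
  open WeightProperties A {n}

  H : EdgeSet n
  H = T₁ ∩ T₂

  w : Dist A n
  w = _⊕_ A d₁ d₂

  H⊆T₁ : H ⊆ᴱ T₁
  H⊆T₁ _ e = proj₁ (∧-true e)

  H⊆T₂ : H ⊆ᴱ T₂
  H⊆T₂ {i} _ e = proj₂ (∧-true {a = T₁ i _} e)

  unshared : Carrier
  unshared = weight A d₁ (T₁ ∖ H) + weight A d₂ (T₂ ∖ H)

  unshared-nonneg : 0# ≤ unshared
  unshared-nonneg =
    ≤-trans (weight-nonneg (T₁ ∖ H) (Metric.nonneg m₁)) (x≤x+y (weight-nonneg (T₂ ∖ H) (Metric.nonneg m₂)))

  split : RSTcost A d₁ d₂ T₁ T₂ ≡ unshared + weight A w H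
  split = RSTcost-split d₁ d₂ H⊆T₁ H⊆T₂

  forest : HasCycle H → ⊥
  forest = proj₂ (proj₂ T₁-tree) ∘ HasCycle-mono H⊆T₁

  open ComponentPaths A w (Metric-⊕ A m₁ m₂) H forest P P-const doubleTree using (⋃-weight)
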